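{- Let $n\ge m\ge 2$ and let $\mathbf{b}=(b_1,\dots,b_{n-m})$ be a sequence of positive integers with $1\le b_i\le i+m-2$ for all $i$. Suppose $1\le i<n-m$ and $b_i>b_{i+1}$. Define $\mathbf{b}'=(b'_1,\dots,b'_{n-m})$ by $b'_i=b_{i+1}$, $b'_{i+1}=b_i+1$, and $b'_j=b_j$ for $j\notin\{i,i+1\}$. Then $\mathbf{A}_n(\mathbf{b})=\mathbf{A}_n(\mathbf{b}')$.
   Context: $\mathcal{P}_N$ is the path graph with vertices $1,\dots,N$ and edges $\{j,j+1\}$. An arithmetical structure on $\mathcal{P}_N$ is a pair $(\mathbf{d},\mathbf{r})$ of positive integer vectors in $\mathbb{Z}^N$ with $\mathbf{r}$ primitive and $(\operatorname{diag}(\mathbf{d})-A)\mathbf{r}=\mathbf{0}$, $A$ the adjacency matrix. The Laplacian arithmetical structure on $\mathcal{P}_N$ is $\mathbf{r}=(1,\dots,1)$, $\mathbf{d}=(1,2,\dots,2,1)$. Subdivision: given an arithmetical structure $(\mathbf{d}',\mathbf{r}')$ on $\mathcal{P}_N$ and $2\le p\le N$, the subdivision at position $p$ is the arithmetical structure $(\mathbf{d},\mathbf{r})$ on $\mathcal{P}_{N+1}$ with $d_j=d'_j$ for $j<p-1$, $d_{p-1}=d'_{p-1}+1$, $d_p=1$, $d_{p+1}=d'_p+1$, $d_j=d'_{j-1}$ for $j>p+1$; and $r_j=r'_j$ for $j<p$, $r_p=r'_{p-1}+r'_p$, $r_j=r'_{j-1}$ for $j>p$ (this corresponds to subdividing the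 edge $\{p-1,p\}$, the $(p-1)$-th edge). Given $2\le m\le n$ and $\mathbf{b}=(b_1,\dots,b_{n-m})$ with $1\le b_i\le m+i-2$, define $\mathbf{A}_n(\mathbf{b})$: start with the Laplacian structure $(\mathbf{d}_0,\mathbf{r}_0)$ on $\mathcal{P}_m$, and for $i=1,\dots,n-m$ let $(\mathbf{d}_i,\mathbf{r}_i)$ on $\mathcal{P}_{m+i}$ be the subdivision of $(\mathbf{d}_{i-1},\mathbf{r}_{i-1})$ at position $b_i+1$ (i.e. subdividing edge number $b_i$); $\mathbf{A}_n(\mathbf{b})=(\mathbf{d}_{n-m},\mathbf{r}_{n-m})$, an arithmetical structure on $\mathcal{P}_n$. (Here $m$ is determined as $n$ minus the length of $\mathbf{b}$; in the lemma the same $m$ is used for $\mathbf{b}$ and $\mathbf{b}'$.) -}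

module Defs where

open import Data.Nat using (ℕ; zero; suc; _+_; _∸_; _≤_; _<_)
open import Data.List using (List; []; _∷_; _++_; take; drop; replicate)
open import Data.Product using (_×_; _,_)
open import Data.Vec using (Vec; lookup; updateAt)
open import Data.Fin using (Fin)

-- An arithmetical structure on a path, represented as a pair (d , r) of
-- lists of naturals (entries d_1..d_N and r_1..r_N, 1-indexed in the paper).
Struct : Set
Struct = List ℕ × List ℕ

-- 1-indexed lookup in a list (default 0 out of range; only used in range).
at : List ℕ → ℕ → ℕ
at []       _             = 0
at (x ∷ xs) 0             = 0
at (x ∷ xs) 1             = x
at (x ∷ xs) (suc (suc k)) = at xs (suc k)

laplacian : ℕ → Struct
laplacian m = (1 ∷ replicate (m ∸ 2) 2 ++ 1 ∷ []) , replicate m 1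

-- Subdivision at position p (2 ≤ p ≤ N), exactly as in the paper:
--  d_j = d'_j (j < p-1), d_{p-1} = d'_{p-1}+1, d_p = 1, d_{p+1} = d'_p + 1,
--  d_j = d'_{j-1} (j > p+1);
--  r_j = r'_j (j < p), r_p = r'_{p-1} + r'_p, r_j = r'_{j-1} (j > p).
subdivide : ℕ → Struct → Struct
subdivide p (d' , r') =
  (take (p ∸ 2) d' ++ (at d' (p ∸ 1) + 1) ∷ 1 ∷ (at d' p + 1) ∷ drop p d')
  , (take (p ∸ 1) r' ++ (at r' (p ∸ 1) + at r' p) ∷ drop (p ∸ 1) r')

-- A_n(b) for b = (b_1,...,b_k), starting from the Laplacian structure on P_m
-- (m = n - k) and subdividing at position b_i + 1 for i = 1..k in order.
subdivList : List ℕ → Struct → Struct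
subdivList []       s = s
subdivList (b ∷ bs) s = subdivList bs (subdivide (suc b) s)

A : (m : ℕ) → List ℕ → Struct
A m bs = subdivList bs (laplacian m)

-- Subdividing edge x and then edge y < x yields the same path as subdividing
-- edge y first and then edge x + 1, which is edge x shifted by the new vertex.
-- Both orders insert the same two vertices and raise the same degrees, so
-- exchanging two such consecutive steps of b leaves A_n(b) unchanged.
module Submission where

open import Defs
open import Data.Nat using (ℕ; zero; suc; _+_; _≤_; _<_; _∸_; s≤s; z≤n; >-nonZero)
open import Data.Nat.Properties
  using (+-comm; +-suc; suc-injective; ≤-trans; m≤n⇒m≤o+n; m≤pred[n]⇒suc[m]≤n)
open import Data.Fin using (Fin; toℕ; zero; suc)
open import Data.Vec using (Vec; _∷_; lookup; toList; updateAt)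
open import Data.List using (List; []; _∷_; _++_; take; drop; length; replicate)
open import Data.List.Properties using (length-replicate; length-++)
open import Data.Product using (_×_; _,_; proj₁; proj₂)
open import Relation.Binary.PropositionalEquality
  using (_≡_; refl; cong; cong₂; sym; subst; module ≡-Reasoning)

-- subdivide (suc b) (d , r) reduces to (subdivideD b d , subdivideR b r).
subdivideD : ℕ → List ℕ → List ℕ
subdivideD b d = take (b ∸ 1) d ++ (at d b + 1) ∷ 1 ∷ (at d (suc b) + 1) ∷ drop (suc b) d

subdivideR : ℕ → List ℕ → List ℕ
subdivideR b r = take b r ++ (at r b + at r (suc b)) ∷ drop b r

subdivideD-comm : ∀ {y x} (d : List ℕ) → 1 ≤ y → y < x → x < length d →
  subdivideD y (subdivideD x d) ≡ subdivideD (suc x) (subdivideD y d)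
subdivideD-comm {1} {1} _ _ (s≤s ()) _
subdivideD-comm {1} {suc _} (_ ∷ []) _ _ (s≤s ())
subdivideD-comm {1} {2} (_ ∷ _ ∷ []) _ _ (s≤s (s≤s ()))
subdivideD-comm {1} {2} (_ ∷ _ ∷ _ ∷ _) _ _ _ = refl
subdivideD-comm {1} {suc (suc (suc _))} (_ ∷ _ ∷ _) _ _ _ = refl
subdivideD-comm {suc (suc _)} {suc (suc _)} (a ∷ d) _ (s≤s y<x) (s≤s x<len) =
  cong (a ∷_) (subdivideD-comm d (s≤s z≤n) y<x x<len)

subdivideR-comm : ∀ {y x} (r : List ℕ) → 1 ≤ y → y < x →
  subdivideR y (subdivideR x r) ≡ subdivideR (suc x) (subdivideR y r)
subdivideR-comm {1} {1} _ _ (s≤s ())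
subdivideR-comm {1} {suc (suc _)} [] _ _ = refl
subdivideR-comm {1} {suc (suc _)} (_ ∷ []) _ _ = refl
subdivideR-comm {1} {suc (suc _)} (_ ∷ _ ∷ _) _ _ = refl
subdivideR-comm {suc (suc _)} {1} _ _ (s≤s ())
subdivideR-comm {suc (suc _)} {suc (suc _)} [] _ _ = refl
subdivideR-comm {suc (suc _)} {suc (suc _)} (a ∷ r) _ (s≤s y<x) =
  cong (a ∷_) (subdivideR-comm r (s≤s z≤n) y<x)

subdivide-comm : ∀ {y x} (d r : List ℕ) → 1 ≤ y → y < x → x < length d →
  subdivide (suc y) (subdivide (suc x) (d , r))
    ≡ subdivide (suc (suc x)) (subdivide (suc y) (d , r))
subdivide-comm d r 1≤y y<x x<len =
  cong₂ _,_ (subdivideD-comm d 1≤y y<x x<len) (subdivideR-comm r 1≤y y<x)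

length-subdivideD : ∀ {b} (d : List ℕ) → 1 ≤ b → b < length d →
  length (subdivideD b d) ≡ suc (length d)
length-subdivideD {1} (_ ∷ []) _ (s≤s ())
length-subdivideD {1} (_ ∷ _ ∷ _) _ _ = refl
length-subdivideD {suc (suc _)} (a ∷ d) _ (s≤s b<len) =
  cong suc (length-subdivideD d (s≤s z≤n) b<len)

-- The i-th subdivision (0-indexed) acts on a path with N + i vertices,
-- whose edges are numbered 1 .. N + i - 1.
ValidEdges : ∀ {k} → ℕ → Vec ℕ k → Set
ValidEdges N b = ∀ j → 1 ≤ lookup b j × lookup b j < toℕ j + N

ValidEdges-tail : ∀ {k N x} {b : Vec ℕ k} → ValidEdges N (x ∷ b) → ValidEdges (suc N) b
ValidEdges-tail {N = N} {b = b} valid j =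
  proj₁ (valid (suc j)) , subst (lookup b j <_) (sym (+-suc (toℕ j) N)) (proj₂ (valid (suc j)))

exchange : ∀ {k} → Vec ℕ k → Fin k → Fin k → Vec ℕ k
exchange b j j' = updateAt (updateAt b j (λ _ → lookup b j')) j' (λ _ → lookup b j + 1)

subdivList-exchange : ∀ {k N} (b : Vec ℕ k) (d r : List ℕ) → length d ≡ N → ValidEdges N b →
  (j j' : Fin k) → toℕ j' ≡ suc (toℕ j) → lookup b j' < lookup b j →
  subdivList (toList b) (d , r) ≡ subdivList (toList (exchange b j j')) (d , r)
subdivList-exchange (x ∷ y ∷ b) d r refl valid zero (suc zero) _ y<x
  rewrite +-comm x 1 =
  cong (subdivList (toList b)) (subdivide-comm d r (proj₁ (valid (suc zero))) y<x (proj₂ (valid zero)))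
subdivList-exchange (x ∷ b) d r refl valid (suc j) (suc j') j'≡1+j lt =
  subdivList-exchange b (subdivideD x d) (subdivideR x r)
    (length-subdivideD d (proj₁ (valid zero)) (proj₂ (valid zero)))
    (ValidEdges-tail valid) j j' (suc-injective j'≡1+j) lt
subdivList-exchange (_ ∷ _ ∷ _) _ _ _ _ zero (suc (suc _)) () _

length-laplacian : ∀ m → 2 ≤ m → length (proj₁ (laplacian m)) ≡ m
length-laplacian (suc zero) (s≤s ())
length-laplacian (suc (suc m)) _ = cong suc (begin
  length (replicate m 2 ++ 1 ∷ []) ≡⟨ length-++ (replicate m 2) ⟩
  length (replicate m 2) + 1       ≡⟨ cong (_+ 1) (length-replicate m) ⟩
  m + 1                            ≡⟨ +-comm m 1 ⟩
  suc m                            ∎)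
  where open ≡-Reasoning

lemma2p13 : (m k : ℕ) → 2 ≤ m → (b : Vec ℕ k) →
  (∀ (j : Fin k) → (1 ≤ lookup b j) × (lookup b j ≤ suc (toℕ j) + m ∸ 2)) →
  (j j' : Fin k) → toℕ j' ≡ suc (toℕ j) →
  lookup b j' < lookup b j →
  A m (toList b)
    ≡ A m (toList (updateAt (updateAt b j (λ _ → lookup b j')) j' (λ _ → lookup b j + 1)))
lemma2p13 m k 2≤m b bounds =
  subdivList-exchange b _ _ (length-laplacian m 2≤m) valid
  where
  -- suc (toℕ j) + m ∸ 2 reduces to pred (toℕ j + m).
  valid : ValidEdges m b
  valid j = proj₁ (bounds j) , m≤pred[n]⇒suc[m]≤n {{>-nonZero 0<j+m}} (proj₂ (bounds j))
    where
    0<j+m : 0 < toℕ j + m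
    0<j+m = m≤n⇒m≤o+n (toℕ j) (≤-trans (s≤s z≤n) 2≤m)
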